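{- Let $\mathcal B'\subseteq\mathcal B\subseteq\mathcal P([n])$ be simply rooted families, and let $B\in\mathcal B'$ be a good set of $\mathcal B$. Then $d_{\mathcal B}(B)=d_{\mathcal B'}(B)$.
   Context: A family $\mathcal F$ is simply rooted if for every nonempty $F\in\mathcal F$ there is $b\in F$ with $\{C:\{b\}\subseteq C\subseteq F\}\subseteq\mathcal F$. For $\mathcal F\subseteq\mathcal P([n])$ and $i\in[n]$: $d_{(i,\mathcal F)}(F)=F\setminus\{i\}$ if $i\in F$ and $F\setminus\{i\}\notin\mathcal F$, else $F$; $d_i(\mathcal F)=\{d_{(i,\mathcal F)}(F):F\in\mathcal F\}$. With $\mathcal F_0=\mathcal F$, $\mathcal F_k=d_k(\mathcal F_{k-1})$, define $d_{\mathcal F}(F)=d_{(n,\mathcal F_{n-1})}\circ\cdots\circ d_{(1,\mathcal F_0)}(F)$ for $F\in\mathcal F$. For a finite set $B$, $\delta B=\{B\setminus\{i\}:i\in B\}$. For a simply rooted family $\mathcal B$, a set $B\in\mathcal B$ is a bad set of $\mathcal B$ if $\delta B\subseteq\mathcal B$ or $d_{\mathcal B}(B)=B$; otherwise it is a good set of $\mathcal B$. -}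

module Defs where

open import Data.Nat using (ℕ; zero; suc)
open import Data.Bool using (Bool; true; false; if_then_else_; _∧_; _∨_; not)
open import Data.Bool.Properties using () renaming (_≟_ to _≟ᵇ_)
open import Data.Fin using (Fin)
open import Data.Fin.Subset using (Subset; _∈_; _⊆_; _-_; ⁅_⁆; Nonempty; outside; inside)
open import Data.Fin.Subset.Properties using (_∈?_)
open import Data.Vec using (Vec; []; _∷_)
open import Data.Vec.Properties using (≡-dec)
open import Data.List using (List; []; _∷_; map; _++_; allFin)
open import Data.Bool.ListAction using (any)
open import Data.Product using (Σ; ∃; _×_; _,_)
open import Data.Sum using (_⊎_)
open import Relation.Nullary using (¬_; Dec; yes; no; does)
open import Relation.Binary.PropositionalEquality using (_≡_)

-- Subsets of [n] are 'Subset n' (Vec Bool n); the ground element i ∈ [n]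
-- is represented by 'Fin n' (element i+1 of the paper corresponds to index i).

Family : ℕ → Set
Family n = Subset n → Bool

_∈𝓕_ : ∀ {n} → Subset n → Family n → Set
F ∈𝓕 𝓕 = 𝓕 F ≡ true

infix 4 _∈𝓕_ _⊆𝓕_

_⊆𝓕_ : ∀ {n} → Family n → Family n → Set
𝓐 ⊆𝓕 𝓑 = ∀ F → F ∈𝓕 𝓐 → F ∈𝓕 𝓑

_≟ˢ_ : ∀ {n} (p q : Subset n) → Dec (p ≡ q)
_≟ˢ_ = ≡-dec _≟ᵇ_

allSubsets : (n : ℕ) → List (Subset n)
allSubsets zero = [] ∷ []
allSubsets (suc n) = map (outside ∷_) (allSubsets n) ++ map (inside ∷_) (allSubsets n)

SimplyRooted : ∀ {n} → Family n → Set
SimplyRooted {n} 𝓕 =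
  ∀ (F : Subset n) → F ∈𝓕 𝓕 → Nonempty F →
    ∃ λ (b : Fin n) → b ∈ F × (∀ (C : Subset n) → ⁅ b ⁆ ⊆ C → C ⊆ F → C ∈𝓕 𝓕)

dElem : ∀ {n} → Fin n → Family n → Subset n → Subset n
dElem i 𝓕 F with i ∈? F
... | yes _ = if 𝓕 (F - i) then F else (F - i)
... | no _ = F

dFam : ∀ {n} → Fin n → Family n → Family n
dFam {n} i 𝓕 G = any (λ F → 𝓕 F ∧ does (dElem i 𝓕 F ≟ˢ G)) (allSubsets n)

dSeq : ∀ {n} → List (Fin n) → Family n → Subset n → Subset n
dSeq [] 𝓕 F = F
dSeq (i ∷ is) 𝓕 F = dSeq is (dFam i 𝓕) (dElem i 𝓕 F)

-- d_𝓕(F) = d_(n,𝓕_{n-1}) ∘ ⋯ ∘ d_(1,𝓕_0) (F), indices in increasing order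
d : ∀ {n} → Family n → Subset n → Subset n
d {n} 𝓕 F = dSeq (allFin n) 𝓕 F

δ⊆ : ∀ {n} → Subset n → Family n → Set
δ⊆ {n} B 𝓑 = ∀ (i : Fin n) → i ∈ B → (B - i) ∈𝓕 𝓑

BadSet : ∀ {n} → Family n → Subset n → Set
BadSet 𝓑 B = δ⊆ B 𝓑 ⊎ d 𝓑 B ≡ B

GoodSet : ∀ {n} → Family n → Subset n → Set
GoodSet 𝓑 B = B ∈𝓕 𝓑 × ¬ BadSet 𝓑 B

module Submission where

open import Defs
open import Data.Nat using (ℕ)
open import Data.Fin.Subset using (Subset)
open import Relation.Binary.PropositionalEquality using (_≡_)

open import Data.Bool using (true; T)
open import Data.Bool.Properties using (T-≡; T-∧; ¬-not) renaming (_≟_ to _≟ᵇ_)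
open import Data.Empty using (⊥-elim)
open import Data.Fin using (Fin; zero; suc)
open import Data.Fin.Properties using () renaming (_≟_ to _≟ᶠ_)
open import Data.Fin.Subset using (_∈_; _∉_; _⊆_; _-_; _─_; _∪_; ⁅_⁆; Nonempty; inside; outside)
open import Data.Fin.Subset.Properties
  using (_∈?_; nonempty?; Empty-unique; ⊆-antisym; ⊆-trans; p─q⊆p; x∈p∧x≢y⇒x∈p-y;
         x∈⁅x⁆; x∈⁅y⁆⇒x≡y; x∈p∪q⁺; x∈p∪q⁻)
open import Data.List using ([]; _∷_; allFin)
open import Data.Vec using ([]; _∷_; here; there)
open import Data.List.Membership.Propositional using (lose) renaming (_∈_ to _∈ₗ_)
open import Data.List.Membership.Propositional.Properties using (∈-map⁺; ∈-++⁺ˡ; ∈-++⁺ʳ)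
open import Data.List.Relation.Unary.Any using (here; satisfied)
open import Data.List.Relation.Unary.Any.Properties using (any⁺; any⁻)
open import Data.Product using (∃; _×_; _,_)
open import Data.Sum using (_⊎_; inj₁; inj₂; [_,_]′)
open import Function using (id; _∘_)
open import Function.Bundles using (Equivalence)
open import Relation.Nullary using (¬_; Dec; yes; no; does)
open import Relation.Nullary.Decidable using (dec-true)
open import Relation.Binary.PropositionalEquality using (refl; sym; cong; subst; trans; _≢_; module ≡-Reasoning)

-- Let r be a root of B in 𝓑′, so the interval [r,B] = {C : r ∈ C ⊆ B} lies
-- in 𝓑′ ⊆ 𝓑, and put A = B ∖ {r}.  As B is good, B is nonempty and A ∉ 𝓑
-- (otherwise δB ⊆ 𝓑).  Compare the two runs of compressions step by step.
-- A compression at j ≠ r fixes B in both runs and preserves: simple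
-- rootedness of the 𝓑-family, inclusion of the 𝓑′-family in it, the interval
-- [r,B] in the 𝓑′-family, and the alternative "A is not in the 𝓑-family, or
-- all subsets of B are".  At step r the second alternative fixes B for good,
-- i.e. d_𝓑(B) = B, which goodness excludes; under the first, B drops to A in
-- both runs, after which every subset of A is present and A never moves.

∈allSubsets : ∀ {n} (F : Subset n) → F ∈ₗ allSubsets n
∈allSubsets [] = here refl
∈allSubsets (outside ∷ F) = ∈-++⁺ˡ (∈-map⁺ (outside ∷_) (∈allSubsets F))
∈allSubsets (inside ∷ F) = ∈-++⁺ʳ _ (∈-map⁺ (inside ∷_) (∈allSubsets F))

module _ {n : ℕ} where

  infix 4 _∉𝓕_ _∈𝓕?_

  _∉𝓕_ : Subset n → Family n → Set
  X ∉𝓕 𝓕 = ¬ X ∈𝓕 𝓕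

  _∈𝓕?_ : ∀ (X : Subset n) 𝓕 → Dec (X ∈𝓕 𝓕)
  X ∈𝓕? 𝓕 = 𝓕 X ≟ᵇ true

  x∈p-y⇒x≢y : ∀ {p : Subset n} {x y} → x ∈ p - y → x ≢ y
  x∈p-y⇒x≢y {p} {x} x∈p-y refl = x∈p─q⇒x∉q p ⁅ x ⁆ x x∈p-y (x∈⁅x⁆ x)
    where
    x∈p─q⇒x∉q : ∀ {m} (p q : Subset m) x → x ∈ p ─ q → x ∉ q
    x∈p─q⇒x∉q (_ ∷ p) (inside ∷ q) zero () here
    x∈p─q⇒x∉q (_ ∷ p) (_ ∷ q) (suc x) (there x∈p─q) (there x∈q) = x∈p─q⇒x∉q p q x x∈p─q x∈q

  y∉p-y : ∀ {p : Subset n} {y} → y ∉ p - y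
  y∉p-y y∈p-y = x∈p-y⇒x≢y y∈p-y refl

  ⊆-y : ∀ {p q : Subset n} {y} → p ⊆ q → y ∉ p → p ⊆ q - y
  ⊆-y {p} p⊆q y∉p x∈p = x∈p∧x≢y⇒x∈p-y (p⊆q x∈p) λ { refl → y∉p x∈p }

  x∈p⇒⁅x⁆⊆p : ∀ {p : Subset n} {x} → x ∈ p → ⁅ x ⁆ ⊆ p
  x∈p⇒⁅x⁆⊆p {p} {x} x∈p y∈⁅x⁆ = subst (_∈ p) (sym (x∈⁅y⁆⇒x≡y x y∈⁅x⁆)) x∈p

  p-y≡p : ∀ {p : Subset n} {y} → y ∉ p → p - y ≡ p
  p-y≡p {p} {y} y∉p = ⊆-antisym (p─q⊆p p ⁅ y ⁆) (⊆-y id y∉p)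

  -y-mono : ∀ {p q : Subset n} {y} → p ⊆ q → p - y ⊆ q - y
  -y-mono {p} {y = y} p⊆q = ⊆-y (⊆-trans (p─q⊆p p ⁅ y ⁆) p⊆q) y∉p-y

  ∪⁅y⁆⊆ : ∀ {p q : Subset n} {y} → p ⊆ q → y ∈ q → p ∪ ⁅ y ⁆ ⊆ q
  ∪⁅y⁆⊆ {p} {y = y} p⊆q y∈q x∈p∪y with x∈p∪q⁻ p ⁅ y ⁆ x∈p∪y
  ... | inj₁ x∈p = p⊆q x∈p
  ... | inj₂ x∈y = subst (_∈ _) (sym (x∈⁅y⁆⇒x≡y y x∈y)) y∈q

  [p∪y]-y≡p : ∀ {p : Subset n} {y} → y ∉ p → (p ∪ ⁅ y ⁆) - y ≡ p
  [p∪y]-y≡p {p} {y} y∉p = ⊆-antisym shrink (⊆-y (λ x∈p → x∈p∪q⁺ (inj₁ x∈p)) y∉p)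
    where
    shrink : (p ∪ ⁅ y ⁆) - y ⊆ p
    shrink x∈ with x∈p∪q⁻ p ⁅ y ⁆ (p─q⊆p _ ⁅ y ⁆ x∈)
    ... | inj₁ x∈p = x∈p
    ... | inj₂ x∈⁅y⁆ = ⊥-elim (x∈p-y⇒x≢y x∈ (x∈⁅y⁆⇒x≡y y x∈⁅y⁆))

  dElem-fixes : ∀ {j 𝓕} {F : Subset n} → (j ∈ F → (F - j) ∈𝓕 𝓕) → dElem j 𝓕 F ≡ F
  dElem-fixes {j} {𝓕} {F} blocked with j ∈? F
  ... | yes j∈F rewrite blocked j∈F = refl
  ... | no _ = refl

  dElem-lowers : ∀ {j 𝓕} {F : Subset n} → j ∈ F → (F - j) ∉𝓕 𝓕 → dElem j 𝓕 F ≡ F - j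
  dElem-lowers {j} {𝓕} {F} j∈F F-j∉ with j ∈? F
  ... | yes _ rewrite ¬-not F-j∉ = refl
  ... | no j∉F = ⊥-elim (j∉F j∈F)

  ∈dFam⁺ : ∀ {j 𝓕} {F G : Subset n} → F ∈𝓕 𝓕 → dElem j 𝓕 F ≡ G → G ∈𝓕 dFam j 𝓕
  ∈dFam⁺ {j} {𝓕} {F} {G} F∈ F↦G =
    Equivalence.to T-≡ (any⁺ _ (lose (∈allSubsets F) (Equivalence.from T-∧
      (Equivalence.from T-≡ F∈ , Equivalence.from T-≡ (dec-true (dElem j 𝓕 F ≟ˢ G) F↦G)))))

  ∈dFam⁻ : ∀ {j 𝓕} {G : Subset n} → G ∈𝓕 dFam j 𝓕 → ∃ λ F → F ∈𝓕 𝓕 × dElem j 𝓕 F ≡ G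
  ∈dFam⁻ {j} {𝓕} {G} G∈ with satisfied (any⁻ _ (allSubsets n) (Equivalence.from T-≡ G∈))
  ... | F , hit with Equivalence.to (T-∧ {𝓕 F}) hit
  ...   | F∈ , F↦G = F , Equivalence.to T-≡ F∈ , witness (dElem j 𝓕 F ≟ˢ G) F↦G
    where
    witness : ∀ {P : Set} (P? : Dec P) → T (does P?) → P
    witness (yes p) _ = p

  data Step (j : Fin n) (𝓕 : Family n) (F : Subset n) : Set where
    stays : (j ∈ F → (F - j) ∈𝓕 𝓕) → dElem j 𝓕 F ≡ F → Step j 𝓕 F
    moves : j ∈ F → (F - j) ∉𝓕 𝓕 → dElem j 𝓕 F ≡ F - j → Step j 𝓕 F

  step : ∀ j 𝓕 (F : Subset n) → Step j 𝓕 F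
  step j 𝓕 F with j ∈? F | (F - j) ∈𝓕? 𝓕
  ... | yes j∈F | no F-j∉ = moves j∈F F-j∉ (dElem-lowers {j} {𝓕} j∈F F-j∉)
  ... | yes _ | yes F-j∈ = stays (λ _ → F-j∈) (dElem-fixes {j} {𝓕} λ _ → F-j∈)
  ... | no j∉F | _ = stays (⊥-elim ∘ j∉F) (dElem-fixes {j} {𝓕} (⊥-elim ∘ j∉F))

  data Origin (j : Fin n) (𝓕 : Family n) (G : Subset n) : Set where
    stayed  : G ∈𝓕 𝓕 → (j ∈ G → (G - j) ∈𝓕 𝓕) → Origin j 𝓕 G
    lowered : ∀ F → F ∈𝓕 𝓕 → j ∈ F → (F - j) ∉𝓕 𝓕 → F - j ≡ G → Origin j 𝓕 G

  origin : ∀ {j 𝓕} {G : Subset n} → G ∈𝓕 dFam j 𝓕 → Origin j 𝓕 G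
  origin {j} {𝓕} G∈ with ∈dFam⁻ {j} {𝓕} G∈
  ... | F , F∈ , F↦G with step j 𝓕 F
  ...   | stays blocked F↦F = subst (Origin j 𝓕) (trans (sym F↦F) F↦G) (stayed F∈ blocked)
  ...   | moves j∈F F-j∉ F↦F-j = lowered F F∈ j∈F F-j∉ (trans (sym F↦F-j) F↦G)

  ∈dFam-stay : ∀ {j 𝓕} {G : Subset n} → G ∈𝓕 𝓕 → (j ∈ G → (G - j) ∈𝓕 𝓕) → G ∈𝓕 dFam j 𝓕
  ∈dFam-stay {j} {𝓕} G∈ blocked = ∈dFam⁺ {j} {𝓕} G∈ (dElem-fixes {j} {𝓕} blocked)

  ∈dFam-lower : ∀ {j 𝓕} {F : Subset n} → F ∈𝓕 𝓕 → (F - j) ∈𝓕 dFam j 𝓕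
  ∈dFam-lower {j} {𝓕} {F} F∈ with (F - j) ∈𝓕? 𝓕 | j ∈? F
  ... | yes F-j∈ | _ = ∈dFam-stay {j} {𝓕} F-j∈ (⊥-elim ∘ y∉p-y)
  ... | no F-j∉ | yes j∈F = ∈dFam⁺ {j} {𝓕} F∈ (dElem-lowers {j} {𝓕} j∈F F-j∉)
  ... | no F-j∉ | no j∉F = ⊥-elim (F-j∉ (subst (_∈𝓕 𝓕) (sym (p-y≡p j∉F)) F∈))

  ∈dFam-raise : ∀ {j 𝓕} {C : Subset n} → j ∉ C → (C ∪ ⁅ j ⁆) ∈𝓕 𝓕 → C ∈𝓕 dFam j 𝓕
  ∈dFam-raise {j} {𝓕} j∉C C+j∈ = subst (_∈𝓕 dFam j 𝓕) ([p∪y]-y≡p j∉C) (∈dFam-lower {j} {𝓕} C+j∈)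

  dFam-mono : ∀ {j} {𝓕′ 𝓕 : Family n} → 𝓕′ ⊆𝓕 𝓕 → dFam j 𝓕′ ⊆𝓕 dFam j 𝓕
  dFam-mono {j} {𝓕′} {𝓕} 𝓕′⊆𝓕 G G∈ with origin {j} {𝓕′} G∈
  ... | stayed G∈′ blocked = ∈dFam-stay {j} {𝓕} (𝓕′⊆𝓕 G G∈′) (𝓕′⊆𝓕 _ ∘ blocked)
  ... | lowered F F∈ _ _ refl = ∈dFam-lower {j} {𝓕} (𝓕′⊆𝓕 F F∈)

  Downset : Subset n → Family n → Set
  Downset D 𝓕 = ∀ C → C ⊆ D → C ∈𝓕 𝓕

  downset-pres : ∀ {j 𝓕} {D : Subset n} → Downset D 𝓕 → Downset D (dFam j 𝓕)
  downset-pres {j} {𝓕} down C C⊆D =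
    ∈dFam-stay {j} {𝓕} (down C C⊆D) λ _ → down (C - j) (⊆-trans (p─q⊆p C ⁅ j ⁆) C⊆D)

  downset-fixed : ∀ is 𝓕 {D : Subset n} → Downset D 𝓕 → dSeq is 𝓕 D ≡ D
  downset-fixed [] 𝓕 down = refl
  downset-fixed (j ∷ is) 𝓕 {D} down = begin
    dSeq is (dFam j 𝓕) (dElem j 𝓕 D)
      ≡⟨ cong (dSeq is (dFam j 𝓕)) (dElem-fixes {j} {𝓕} λ _ → down (D - j) (p─q⊆p D ⁅ j ⁆)) ⟩
    dSeq is (dFam j 𝓕) D
      ≡⟨ downset-fixed is (dFam j 𝓕) (downset-pres {j} {𝓕} down) ⟩
    D ∎
    where open ≡-Reasoning

  Interval : Family n → Fin n → Subset n → Set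
  Interval 𝓕 b F = ∀ C → b ∈ C → C ⊆ F → C ∈𝓕 𝓕

  interval-mono : ∀ {𝓕′ 𝓕 b} {F : Subset n} → 𝓕′ ⊆𝓕 𝓕 → Interval 𝓕′ b F → Interval 𝓕 b F
  interval-mono 𝓕′⊆𝓕 I C b∈C C⊆F = 𝓕′⊆𝓕 C (I C b∈C C⊆F)

  Root : Family n → Subset n → Set
  Root 𝓕 F = ∃ λ b → b ∈ F × Interval 𝓕 b F

  root : ∀ {𝓕} → SimplyRooted 𝓕 → ∀ {F} → F ∈𝓕 𝓕 → Nonempty F → Root 𝓕 F
  root sr F∈ F≠∅ with sr _ F∈ F≠∅
  ... | b , b∈F , I = b , b∈F , λ C b∈C C⊆F → I C (x∈p⇒⁅x⁆⊆p b∈C) C⊆F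

  simplyRooted : ∀ {𝓕} → (∀ F → F ∈𝓕 𝓕 → Nonempty F → Root 𝓕 F) → SimplyRooted 𝓕
  simplyRooted roots F F∈ F≠∅ with roots F F∈ F≠∅
  ... | b , b∈F , I = b , b∈F , λ C ⁅b⁆⊆C C⊆F → I C (⁅b⁆⊆C (x∈⁅x⁆ b)) C⊆F

  interval-pres : ∀ {j b 𝓕} {F : Subset n} → b ≢ j → Interval 𝓕 b F → Interval (dFam j 𝓕) b F
  interval-pres {j} {b} {𝓕} b≢j I C b∈C C⊆F =
    ∈dFam-stay {j} {𝓕} (I C b∈C C⊆F) λ _ → I (C - j) (x∈p∧x≢y⇒x∈p-y b∈C b≢j) (⊆-trans (p─q⊆p C ⁅ j ⁆) C⊆F)

  -- If j is a root of F, compressing at j makes the whole downset of F - j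
  -- present: each C ⊆ F - j arises from C ∪ {j} ∈ [j,F].
  interval-collapse : ∀ {j 𝓕} {F : Subset n} → Interval 𝓕 j F → j ∈ F → Downset (F - j) (dFam j 𝓕)
  interval-collapse {j} {𝓕} {F} I j∈F C C⊆F-j =
    ∈dFam-raise {j} {𝓕} (λ j∈C → y∉p-y (C⊆F-j j∈C))
      (I (C ∪ ⁅ j ⁆) (x∈p∪q⁺ (inj₂ (x∈⁅x⁆ j))) (∪⁅y⁆⊆ (⊆-trans C⊆F-j (p─q⊆p F ⁅ j ⁆)) j∈F))

  interval-merge : ∀ {j c 𝓕} {F : Subset n} →
                   Interval 𝓕 j F → c ∈ F - j → Interval 𝓕 c (F - j) → Interval (dFam j 𝓕) c F
  interval-merge {j} {c} {𝓕} Ij c∈F-j Ic C c∈C C⊆F =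
    ∈dFam-stay {j} {𝓕} C∈ λ _ → Ic (C - j) (x∈p∧x≢y⇒x∈p-y c∈C (x∈p-y⇒x≢y c∈F-j)) (-y-mono C⊆F)
    where
    C∈ : C ∈𝓕 𝓕
    C∈ with j ∈? C
    ... | yes j∈C = Ij C j∈C C⊆F
    ... | no j∉C = Ic C c∈C (⊆-y C⊆F j∉C)

  -- A set moved by d_(j,𝓕) has j as a root: a root b ≠ j would put F - j in 𝓕.
  moved-root : ∀ {j 𝓕} {F : Subset n} → SimplyRooted 𝓕 → F ∈𝓕 𝓕 → j ∈ F → (F - j) ∉𝓕 𝓕 → Interval 𝓕 j F
  moved-root {j} {𝓕} {F} sr F∈ j∈F F-j∉ with root sr F∈ (j , j∈F)
  ... | b , b∈F , I with b ≟ᶠ j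
  ...   | yes refl = I
  ...   | no b≢j = ⊥-elim (F-j∉ (I (F - j) (x∈p∧x≢y⇒x∈p-y b∈F b≢j) (p─q⊆p F ⁅ j ⁆)))

  -- A set G rooted at j that d_(j,𝓕) does not move still has a root in d_j(𝓕):
  -- a root of G - j if G - j ≠ ∅, and j itself if G = {j}.
  blocked-root : ∀ {j 𝓕} {G : Subset n} → SimplyRooted 𝓕 →
                 Interval 𝓕 j G → j ∈ G → (G - j) ∈𝓕 𝓕 → Root (dFam j 𝓕) G
  blocked-root {j} {𝓕} {G} sr Ij j∈G G-j∈ with nonempty? (G - j)
  ... | yes G-j≠∅ with root sr G-j∈ G-j≠∅
  ...   | c , c∈G-j , Ic = c , p─q⊆p G ⁅ j ⁆ c∈G-j , interval-merge Ij c∈G-j Ic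
  blocked-root {j} {𝓕} {G} sr Ij j∈G G-j∈ | no G-j=∅ =
    j , j∈G , λ C j∈C C⊆G → ∈dFam-stay {j} {𝓕} (Ij C j∈C C⊆G) λ _ → subst (_∈𝓕 𝓕) (G-j≡C-j C⊆G) G-j∈
    where
    G-j≡C-j : ∀ {C} → C ⊆ G → G - j ≡ C - j
    G-j≡C-j C⊆G = trans (Empty-unique G-j=∅)
                        (sym (Empty-unique λ { (x , x∈C-j) → G-j=∅ (x , -y-mono C⊆G x∈C-j) }))

  dFam-simplyRooted : ∀ {j 𝓕} → SimplyRooted 𝓕 → SimplyRooted {n} (dFam j 𝓕)
  dFam-simplyRooted {j} {𝓕} sr = simplyRooted roots
    where
    roots : ∀ G → G ∈𝓕 dFam j 𝓕 → Nonempty G → Root (dFam j 𝓕) G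
    roots G G∈ G≠∅ with origin {j} {𝓕} G∈
    ... | lowered F F∈ j∈F F-j∉ refl with G≠∅
    ...   | g , g∈G = g , g∈G , λ C _ C⊆G → interval-collapse (moved-root sr F∈ j∈F F-j∉) j∈F C C⊆G
    roots G G∈ G≠∅ | stayed G∈′ blocked with root sr G∈′ G≠∅
    ... | b , b∈G , I with b ≟ᶠ j
    ...   | no b≢j = b , b∈G , interval-pres b≢j I
    ...   | yes refl = blocked-root sr I b∈G (blocked b∈G)

  module Comparison (r : Fin n) (B : Subset n) (r∈B : r ∈ B) where

    A : Subset n
    A = B - r

    -- With [r,B] ⊆ 𝓕, A ∈ 𝓕 already gives δB ⊆ 𝓕: every B - i with i ≠ r lies in [r,B].
    δ⊆-from-A : ∀ {𝓕} → Interval 𝓕 r B → A ∈𝓕 𝓕 → δ⊆ B 𝓕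
    δ⊆-from-A I A∈ i i∈B with i ≟ᶠ r
    ... | yes refl = A∈
    ... | no i≢r = I (B - i) (x∈p∧x≢y⇒x∈p-y r∈B (i≢r ∘ sym)) (p─q⊆p B ⁅ i ⁆)

    B-fixed : ∀ {j 𝓕} → j ≢ r → Interval 𝓕 r B → dElem j 𝓕 B ≡ B
    B-fixed {j} {𝓕} j≢r I =
      dElem-fixes {j} {𝓕} λ _ → I (B - j) (x∈p∧x≢y⇒x∈p-y r∈B (j≢r ∘ sym)) (p─q⊆p B ⁅ j ⁆)

    Alternative : Family n → Set
    Alternative 𝓕 = A ∉𝓕 𝓕 ⊎ Downset B 𝓕

    -- If A enters at step j ≠ r, it enters as F - j for F rooted at j with j ∉ B;
    -- then every subset of B lies in d_j(𝓕).
    A-enters : ∀ {j 𝓕} → j ≢ r → SimplyRooted 𝓕 → Interval 𝓕 r B →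
               A ∉𝓕 𝓕 → A ∈𝓕 dFam j 𝓕 → Downset B (dFam j 𝓕)
    A-enters {j} {𝓕} j≢r sr I A∉ A∈ with origin {j} {𝓕} A∈
    ... | stayed A∈𝓕 _ = ⊥-elim (A∉ A∈𝓕)
    ... | lowered F F∈ j∈F F-j∉ F-j≡A = downset
      where
      j∉B : j ∉ B
      j∉B j∈B = y∉p-y (subst (j ∈_) (sym F-j≡A) (x∈p∧x≢y⇒x∈p-y j∈B j≢r))

      downset : Downset B (dFam j 𝓕)
      downset C C⊆B with r ∈? C
      ... | yes r∈C = ∈dFam-stay {j} {𝓕} (I C r∈C C⊆B) (⊥-elim ∘ j∉B ∘ C⊆B)
      ... | no r∉C = interval-collapse (moved-root sr F∈ j∈F F-j∉) j∈F C
                       (subst (C ⊆_) (sym F-j≡A) (⊆-y C⊆B r∉C))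

    alternative-pres : ∀ {j 𝓕} → j ≢ r → SimplyRooted 𝓕 → Interval 𝓕 r B →
                       Alternative 𝓕 → Alternative (dFam j 𝓕)
    alternative-pres {j} {𝓕} _ _ _ (inj₂ downset) = inj₂ (downset-pres {j} {𝓕} downset)
    alternative-pres {j} {𝓕} j≢r sr I (inj₁ A∉) with A ∈𝓕? dFam j 𝓕
    ... | yes A∈ = inj₂ (A-enters j≢r sr I A∉ A∈)
    ... | no A∉′ = inj₁ A∉′

    record Invariant (𝓕 𝓕′ : Family n) : Set where
      field
        rooted      : SimplyRooted 𝓕
        included    : 𝓕′ ⊆𝓕 𝓕
        interval    : Interval 𝓕′ r B
        alternative : Alternative 𝓕

    invariant-pres : ∀ {j 𝓕 𝓕′} → j ≢ r → Invariant 𝓕 𝓕′ → Invariant (dFam j 𝓕) (dFam j 𝓕′)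
    invariant-pres {j} {𝓕} {𝓕′} j≢r inv = record
      { rooted      = dFam-simplyRooted {j} rooted
      ; included    = dFam-mono {j} included
      ; interval    = interval-pres (j≢r ∘ sym) interval
      ; alternative = alternative-pres j≢r rooted (interval-mono included interval) alternative
      }
      where open Invariant inv

    -- At step r: either B is fixed for good, or B drops to A in both runs,
    -- where A has a complete downset and stays.
    run-from-r : ∀ is {𝓕 𝓕′} → Invariant 𝓕 𝓕′ →
                 dSeq (r ∷ is) 𝓕 B ≡ B ⊎ dSeq (r ∷ is) 𝓕 B ≡ dSeq (r ∷ is) 𝓕′ B
    run-from-r is {𝓕} inv with Invariant.alternative inv
    ... | inj₂ downset = inj₁ (downset-fixed (r ∷ is) 𝓕 downset)
    run-from-r is {𝓕} {𝓕′} inv | inj₁ A∉ = inj₂ (begin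
      dSeq is (dFam r 𝓕) (dElem r 𝓕 B)     ≡⟨ cong (dSeq is (dFam r 𝓕)) (dElem-lowers {r} {𝓕} r∈B A∉) ⟩
      dSeq is (dFam r 𝓕) A                  ≡⟨ downset-fixed is (dFam r 𝓕) (interval-collapse interval-𝓕 r∈B) ⟩
      A                                     ≡⟨ sym (downset-fixed is (dFam r 𝓕′) (interval-collapse interval r∈B)) ⟩
      dSeq is (dFam r 𝓕′) A                 ≡⟨ cong (dSeq is (dFam r 𝓕′)) (sym (dElem-lowers {r} {𝓕′} r∈B A∉′)) ⟩
      dSeq is (dFam r 𝓕′) (dElem r 𝓕′ B)   ∎)
      where
      open ≡-Reasoning
      open Invariant inv
      interval-𝓕 : Interval 𝓕 r B
      interval-𝓕 = interval-mono included interval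
      A∉′ : A ∉𝓕 𝓕′
      A∉′ = A∉ ∘ included A

    run : ∀ is {𝓕 𝓕′} → Invariant 𝓕 𝓕′ → dSeq is 𝓕 B ≡ B ⊎ dSeq is 𝓕 B ≡ dSeq is 𝓕′ B
    run [] _ = inj₁ refl
    run (j ∷ is) inv with j ≟ᶠ r
    ... | yes refl = run-from-r is inv
    ... | no j≢r
      rewrite B-fixed j≢r (interval-mono (Invariant.included inv) (Invariant.interval inv))
            | B-fixed j≢r (Invariant.interval inv)
      = run is (invariant-pres j≢r inv)

lemma16 : ∀ (n : ℕ) (𝓑 𝓑′ : Family n) →
            SimplyRooted 𝓑 → SimplyRooted 𝓑′ → 𝓑′ ⊆𝓕 𝓑 →
            ∀ (B : Subset n) → B ∈𝓕 𝓑′ → GoodSet 𝓑 B →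
            d 𝓑 B ≡ d 𝓑′ B
lemma16 n 𝓑 𝓑′ sr sr′ 𝓑′⊆𝓑 B B∈𝓑′ (_ , notBad) with nonempty? B
... | no B=∅ = ⊥-elim (notBad (inj₁ λ i i∈B → ⊥-elim (B=∅ (i , i∈B))))
... | yes B≠∅ with root sr′ B∈𝓑′ B≠∅
... | r , r∈B , r-interval =
  [ (λ B-fixed → ⊥-elim (notBad (inj₂ B-fixed))) , id ]′ (run (allFin n) start)
  where
  open Comparison r B r∈B
  A∉𝓑 : A ∉𝓕 𝓑
  A∉𝓑 = notBad ∘ inj₁ ∘ δ⊆-from-A (interval-mono 𝓑′⊆𝓑 r-interval)
  start : Invariant 𝓑 𝓑′
  start = record { rooted = sr ; included = 𝓑′⊆𝓑 ; interval = r-interval ; alternative = inj₁ A∉𝓑 }
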